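{- Fix a zero divisor $a\in\mathbb{Z}/m\mathbb{Z}$. Let $C_n$ be the cycle with vertices $v_1,\dots,v_n$ and edges $\ell_i=v_iv_{i+1}$ for $1\le i\le n-1$ and $\ell_n=v_nv_1$, and suppose every edge is labeled by a power of $a$, the edge $\ell_i$ carrying the ideal $\langle a^{k_i}\rangle$, where the exponent $k_n$ of the label on $\ell_n$ is minimal among $k_1,\dots,k_n$. Write $\ell_i$ also for the label $a^{k_i}$. For $1\le i\le n-1$ let $b^{(i)}$ be the vertex-labeling with $b^{(i)}_{v_j}=0$ for $j\le i$ and $b^{(i)}_{v_j}=\ell_i$ for $j>i$, and let $\mathbf{1}$ be the all-ones vertex-labeling. Then $\{\mathbf{1},b^{(1)},\dots,b^{(n-1)}\}$ generates the $\mathbb{Z}$-module of all splines on $C_n$ over $\mathbb{Z}/m\mathbb{Z}$.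
   Context: For a finite graph $G=(V,E)$ with edge-labeling by ideals of $R=\mathbb{Z}/m\mathbb{Z}$, a spline is $f\in R^{|V|}$ with $f_u-f_v$ in the ideal labeling $uv$ for every edge $uv$. -}

module Defs where

open import Data.Nat using (ℕ; zero; suc; _≤_)
open import Data.Integer using (ℤ; +_; _+_; _-_; _*_; _^_; 0ℤ; 1ℤ)
open import Data.Integer.Divisibility using (_∣_)
open import Data.Fin using (Fin; zero; suc; toℕ; inject₁; fromℕ)
open import Data.Product using (Σ; ∃; _×_)
open import Relation.Nullary using (¬_)

-- The ring ℤ/mℤ is modelled by integer representatives together with
-- congruence modulo m:  x ≡ y (mod m)  iff  m ∣ x - y.
_≡_[mod_] : ℤ → ℤ → ℕ → Set
x ≡ y [mod m ] = (+ m) ∣ (x - y)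

IsZeroDivisor : ℕ → ℤ → Set
IsZeroDivisor m a = Σ ℤ λ b → (¬ (b ≡ 0ℤ [mod m ])) × ((a * b) ≡ 0ℤ [mod m ])

InIdeal : ℕ → ℤ → ℤ → Set
InIdeal m g x = Σ ℤ λ c → x ≡ c * g [mod m ]

-- The cycle C_n with n = suc p vertices v_0,…,v_p (paper's v_1,…,v_n).
IsCycleSpline : (m : ℕ) (p : ℕ) (a : ℤ) (k : Fin p → ℕ) (kn : ℕ) → (Fin (suc p) → ℤ) → Set
IsCycleSpline m p a k kn f =
  ((i : Fin p) → InIdeal m (a ^ k i) (f (inject₁ i) - f (suc i)))
  × InIdeal m (a ^ kn) (f (fromℕ p) - f zero)

one : (p : ℕ) → Fin (suc p) → ℤ
one p j = 1ℤ

bvec : (p : ℕ) (a : ℤ) (k : Fin p → ℕ) → Fin p → Fin (suc p) → ℤ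
bvec p a k i j with Data.Nat._≤?_ (toℕ j) (toℕ i)
... | Relation.Nullary.yes _ = 0ℤ
... | Relation.Nullary.no _ = a ^ k i

sumFin : (p : ℕ) → (Fin p → ℤ) → ℤ
sumFin zero g = 0ℤ
sumFin (suc p) g = g zero + sumFin p (λ i → g (suc i))

InSpan : (m p : ℕ) (a : ℤ) (k : Fin p → ℕ) → (Fin (suc p) → ℤ) → Set
InSpan m p a k f =
  Σ ℤ λ z₀ → Σ (Fin p → ℤ) λ z →
    (j : Fin (suc p)) → f j ≡ (z₀ * one p j + sumFin p (λ i → z i * bvec p a k i j)) [mod m ]

module Submission where

-- Along the path b⁽ⁱ⁾ jumps exactly once, by ℓᵢ across the edge
-- ℓᵢ (lemma b-jump); across the closing edge it changes by ℓᵢ, which lies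
-- in ⟨a^kn⟩ because kn ≤ k i.  Hence 1 and all b⁽ⁱ⁾ are splines.
--
-- Conversely, let f be a spline with f(vⱼ) - f(vⱼ₊₁) ≡ cⱼ·ℓⱼ.  By the jump
-- lemma the combination Σᵢ zᵢ·b⁽ⁱ⁾ increases by exactly zⱼ·ℓⱼ across ℓⱼ
-- (lemma combination-step), so for zⱼ = -cⱼ the labelings f and
-- f(v₀)·1 + Σᵢ zᵢ·b⁽ⁱ⁾ agree at v₀ and change alike along the path; by
-- induction along the path they agree modulo m everywhere.

open import Defs
open import Data.Nat using (ℕ; suc; _≤_)
open import Data.Integer using (ℤ)
open import Data.Fin using (Fin)
open import Data.Product using (_×_)

import Data.Nat as ℕ
import Data.Nat.Properties as ℕ
open import Data.Integer using (+_; _+_; _-_; _*_; _^_; -_; 0ℤ; 1ℤ; -1ℤ)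
import Data.Integer.Properties as ℤ
open import Data.Integer.Divisibility using (_∣_)
import Data.Integer.Divisibility.Signed as Signed
import Data.Nat.Divisibility as ℕᵈ
open import Data.Integer.Tactic.RingSolver using (solve-∀)
open import Data.Fin using (zero; suc; toℕ; inject₁; fromℕ; _≟_)
import Data.Fin.Properties as Fin
open import Data.Fin.Induction using (<-weakInduction)
open import Data.Product using (_,_; proj₁; proj₂)
open import Data.Bool using (if_then_else_)
open import Level using (0ℓ)
open import Algebra.Properties.CommutativeMonoid.Sum ℤ.+-0-commutativeMonoid
  using (sum; ∑-distrib-+; sum-cong-≗; sum-replicate-zero)
open import Relation.Binary.Bundles using (Setoid)
open import Relation.Binary.PropositionalEquality
open import Relation.Nullary using (¬_; yes; no; does; contradiction)
open import Relation.Binary.Definitions using (tri<; tri≈; tri>)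
open import Relation.Nullary.Decidable using (dec-true; dec-false)

module _ {m : ℕ} where

  ≡⇒≡[mod] : ∀ {x y} → x ≡ y → x ≡ y [mod m ]
  ≡⇒≡[mod] {x} refl =
    Signed.∣⇒∣ᵤ {+ m} (Signed.divides 0ℤ (trans (ℤ.+-inverseʳ x) (sym (ℤ.*-zeroˡ (+ m)))))

  mod-sym : ∀ {x y} → x ≡ y [mod m ] → y ≡ x [mod m ]
  mod-sym {x} {y} = subst (ℕᵈ._∣_ m) (ℤ.∣i-j∣≡∣j-i∣ x y)

  mod-trans : ∀ {x y z} → x ≡ y [mod m ] → y ≡ z [mod m ] → x ≡ z [mod m ]
  mod-trans {x} {y} {z} x≡y y≡z = Signed.∣⇒∣ᵤ {+ m}
    (subst (Signed._∣_ (+ m)) (ℤ.+-minus-telescope x y z)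
      (Signed.∣m∣n⇒∣m+n (Signed.∣ᵤ⇒∣ {+ m} {x - y} x≡y) (Signed.∣ᵤ⇒∣ {+ m} {y - z} y≡z)))

  mod-by-difference : ∀ {x y x′ y′} → x - y ≡ x′ - y′ → x ≡ y [mod m ] → x′ ≡ y′ [mod m ]
  mod-by-difference eq = subst (λ d → + m ∣ d) eq

  mod-+ʳ : ∀ x y w → x ≡ y [mod m ] → (x + w) ≡ y + w [mod m ]
  mod-+ʳ x y w = mod-by-difference {x} {y} {x + w} {y + w} (difference-invariant x y w)
    where
    difference-invariant : ∀ x y w → x - y ≡ (x + w) - (y + w)
    difference-invariant = solve-∀

  mod-from-difference : ∀ x y c g → (x - y) ≡ c * g [mod m ] → y ≡ x + (- c) * g [mod m ]
  mod-from-difference x y c g h =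
    mod-by-difference {c * g} {x - y} {y} (rearrange x y c g) (mod-sym {x - y} {c * g} h)
    where
    rearrange : ∀ x y c g → c * g - (x - y) ≡ y - (x + (- c) * g)
    rearrange = solve-∀

modSetoid : ℕ → Setoid 0ℓ 0ℓ
modSetoid m = record
  { Carrier = ℤ
  ; _≈_ = λ x y → x ≡ y [mod m ]
  ; isEquivalence = record
    { refl = λ {x} → ≡⇒≡[mod] {m} {x} refl
    ; sym = λ {x} {y} → mod-sym {m} {x} {y}
    ; trans = λ {x} {y} {z} → mod-trans {m} {x} {y} {z}
    }
  }

power-in-ideal : ∀ m (a : ℤ) {e f} → e ≤ f → InIdeal m (a ^ e) (a ^ f)
power-in-ideal m a {e} {f} e≤f = a ^ (f ℕ.∸ e) , ≡⇒≡[mod] (begin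
  a ^ f                    ≡⟨ cong (a ^_) (ℕ.m∸n+n≡m e≤f) ⟨
  a ^ (f ℕ.∸ e ℕ.+ e)      ≡⟨ ℤ.^-distribˡ-+-* a (f ℕ.∸ e) e ⟩
  a ^ (f ℕ.∸ e) * a ^ e    ∎)
  where open ≡-Reasoning

sumFin≡sum : ∀ p (g : Fin p → ℤ) → sumFin p g ≡ sum g
sumFin≡sum ℕ.zero g = refl
sumFin≡sum (suc p) g = cong (λ s → g zero + s) (sumFin≡sum p (λ i → g (suc i)))

sumFin-zero : ∀ p → sumFin p (λ _ → 0ℤ) ≡ 0ℤ
sumFin-zero p = trans (sumFin≡sum p _) (sum-replicate-zero p)

kronecker : ∀ {n} → Fin n → Fin n → ℤ → ℤ
kronecker i j x = if does (i ≟ j) then x else 0ℤ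

kronecker-diag : ∀ {n} (i : Fin n) x → kronecker i i x ≡ x
kronecker-diag i x rewrite dec-true (i ≟ i) refl = refl

kronecker-off : ∀ {n} {i j : Fin n} x → ¬ i ≡ j → kronecker i j x ≡ 0ℤ
kronecker-off {i = i} {j} x i≢j rewrite dec-false (i ≟ j) i≢j = refl

*-kronecker : ∀ {n} (i j : Fin n) z x → z * kronecker i j x ≡ kronecker i j (z * x)
*-kronecker i j z x with i ≟ j
... | yes _ = refl
... | no _ = ℤ.*-zeroʳ z

sum-kronecker : ∀ p (g : Fin p → ℤ) j → sumFin p (λ i → kronecker i j (g i)) ≡ g j
sum-kronecker (suc p) g zero =
  trans (cong (λ s → g zero + s) (sumFin-zero p)) (ℤ.+-identityʳ (g zero))
sum-kronecker (suc p) g (suc j) =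
  trans (ℤ.+-identityˡ _) (sum-kronecker p (λ i → g (suc i)) j)

module Generators (p : ℕ) (a : ℤ) (k : Fin p → ℕ) where

  open ≡-Reasoning

  b : Fin p → Fin (suc p) → ℤ
  b = bvec p a k

  b-below : ∀ i j → toℕ j ≤ toℕ i → b i j ≡ 0ℤ
  b-below i j j≤i with toℕ j ℕ.≤? toℕ i
  ... | yes _ = refl
  ... | no j≰i = contradiction j≤i j≰i

  b-above : ∀ i j → toℕ i ℕ.< toℕ j → b i j ≡ a ^ k i
  b-above i j i<j with toℕ j ℕ.≤? toℕ i
  ... | yes j≤i = contradiction j≤i (ℕ.<⇒≱ i<j)
  ... | no _ = refl

  b-jump : ∀ i j → b i (suc j) ≡ b i (inject₁ j) + kronecker i j (a ^ k i)
  b-jump i j with Fin.<-cmp i j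
  ... | tri< i<j i≢j _ = begin
    b i (suc j)                             ≡⟨ b-above i (suc j) (ℕ.m<n⇒m<1+n i<j) ⟩
    a ^ k i                                 ≡⟨ ℤ.+-identityʳ (a ^ k i) ⟨
    a ^ k i + 0ℤ                            ≡⟨ cong₂ _+_ (b-above i (inject₁ j) i<inject₁j)
                                                         (kronecker-off (a ^ k i) i≢j) ⟨
    b i (inject₁ j) + kronecker i j (a ^ k i) ∎
    where
    i<inject₁j : toℕ i ℕ.< toℕ (inject₁ j)
    i<inject₁j = subst (toℕ i ℕ.<_) (sym (Fin.toℕ-inject₁ j)) i<j
  ... | tri≈ _ refl _ = begin
    b i (suc i)                             ≡⟨ b-above i (suc i) ℕ.≤-refl ⟩
    a ^ k i                                 ≡⟨ ℤ.+-identityˡ (a ^ k i) ⟨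
    0ℤ + a ^ k i                            ≡⟨ cong₂ _+_ (b-below i (inject₁ i) inject₁i≤i)
                                                         (kronecker-diag i (a ^ k i)) ⟨
    b i (inject₁ i) + kronecker i i (a ^ k i) ∎
    where
    inject₁i≤i : toℕ (inject₁ i) ≤ toℕ i
    inject₁i≤i = ℕ.≤-reflexive (Fin.toℕ-inject₁ i)
  ... | tri> _ i≢j j<i = begin
    b i (suc j)                             ≡⟨ b-below i (suc j) j<i ⟩
    0ℤ                                      ≡⟨ cong₂ _+_ (b-below i (inject₁ j) inject₁j≤i)
                                                         (kronecker-off (a ^ k i) i≢j) ⟨
    b i (inject₁ j) + kronecker i j (a ^ k i) ∎
    where
    inject₁j≤i : toℕ (inject₁ j) ≤ toℕ i
    inject₁j≤i = ℕ.≤-trans (ℕ.≤-reflexive (Fin.toℕ-inject₁ j)) (ℕ.<⇒≤ j<i)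

  combination : (Fin p → ℤ) → Fin (suc p) → ℤ
  combination z j = sumFin p (λ i → z i * b i j)

  combination-start : ∀ z → combination z zero ≡ 0ℤ
  combination-start z = begin
    sumFin p (λ i → z i * b i zero) ≡⟨ sumFin≡sum p _ ⟩
    sum (λ i → z i * b i zero)      ≡⟨ sum-cong-≗ vanishes ⟩
    sum {p} (λ _ → 0ℤ)              ≡⟨ sum-replicate-zero p ⟩
    0ℤ                              ∎
    where
    vanishes : ∀ i → z i * b i zero ≡ 0ℤ
    vanishes i = trans (cong (z i *_) (b-below i zero ℕ.z≤n)) (ℤ.*-zeroʳ (z i))

  -- Across the edge ℓⱼ only the generator b⁽ʲ⁾ jumps, so the combination
  -- increases by zⱼ·ℓⱼ.
  combination-step : ∀ z j → combination z (suc j) ≡ combination z (inject₁ j) + z j * a ^ k j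
  combination-step z j = begin
    sumFin p (λ i → z i * b i (suc j))
      ≡⟨ sumFin≡sum p _ ⟩
    sum (λ i → z i * b i (suc j))
      ≡⟨ sum-cong-≗ weighted-jump ⟩
    sum (λ i → z i * b i (inject₁ j) + kronecker i j (z i * a ^ k i))
      ≡⟨ ∑-distrib-+ (λ i → z i * b i (inject₁ j)) (λ i → kronecker i j (z i * a ^ k i)) ⟩
    sum (λ i → z i * b i (inject₁ j)) + sum (λ i → kronecker i j (z i * a ^ k i))
      ≡⟨ cong₂ _+_ (sumFin≡sum p _) (sumFin≡sum p _) ⟨
    combination z (inject₁ j) + sumFin p (λ i → kronecker i j (z i * a ^ k i))
      ≡⟨ cong (λ s → combination z (inject₁ j) + s) (sum-kronecker p (λ i → z i * a ^ k i) j) ⟩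
    combination z (inject₁ j) + z j * a ^ k j
      ∎
    where
    weighted-jump : ∀ i → z i * b i (suc j) ≡ z i * b i (inject₁ j) + kronecker i j (z i * a ^ k i)
    weighted-jump i = begin
      z i * b i (suc j)                                   ≡⟨ cong (z i *_) (b-jump i j) ⟩
      z i * (b i (inject₁ j) + kronecker i j (a ^ k i))   ≡⟨ ℤ.*-distribˡ-+ (z i) _ _ ⟩
      z i * b i (inject₁ j) + z i * kronecker i j (a ^ k i)
        ≡⟨ cong (λ s → z i * b i (inject₁ j) + s) (*-kronecker i j (z i) (a ^ k i)) ⟩
      z i * b i (inject₁ j) + kronecker i j (z i * a ^ k i) ∎

  -- The difference of b⁽ⁱ⁾ along the edge ℓⱼ, in the orientation used by
  -- the spline condition.
  b-drop : ∀ i j → b i (inject₁ j) - b i (suc j) ≡ - kronecker i j (a ^ k i)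
  b-drop i j = begin
    b i (inject₁ j) - b i (suc j)
      ≡⟨ cong (λ s → b i (inject₁ j) - s) (b-jump i j) ⟩
    b i (inject₁ j) - (b i (inject₁ j) + kronecker i j (a ^ k i))
      ≡⟨ cancel (b i (inject₁ j)) _ ⟩
    - kronecker i j (a ^ k i)
      ∎
    where
    cancel : ∀ x d → x - (x + d) ≡ - d
    cancel = solve-∀

module CycleSplines (m p : ℕ) (a : ℤ) (k : Fin p → ℕ) (kn : ℕ) where

  open Generators p a k

  zero-in-ideal : ∀ g {x} → x ≡ 0ℤ → InIdeal m g x
  zero-in-ideal g x≡0 = 0ℤ , ≡⇒≡[mod] (trans x≡0 (sym (ℤ.*-zeroˡ g)))

  one-isSpline : IsCycleSpline m p a k kn (one p)
  one-isSpline = (λ i → zero-in-ideal (a ^ k i) refl) , zero-in-ideal (a ^ kn) refl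

  b-path-edge : ∀ i j → InIdeal m (a ^ k j) (b i (inject₁ j) - b i (suc j))
  b-path-edge i j with i ≟ j
  ... | yes refl = -1ℤ , ≡⇒≡[mod] (begin
    b i (inject₁ i) - b i (suc i) ≡⟨ b-drop i i ⟩
    - kronecker i i (a ^ k i)     ≡⟨ cong -_ (kronecker-diag i (a ^ k i)) ⟩
    - a ^ k i                     ≡⟨ ℤ.-1*i≡-i (a ^ k i) ⟨
    -1ℤ * a ^ k i                 ∎)
    where open ≡-Reasoning
  ... | no i≢j = zero-in-ideal (a ^ k j) (trans (b-drop i j) (cong -_ (kronecker-off (a ^ k i) i≢j)))

  b-closing-edge : ∀ i → kn ≤ k i → InIdeal m (a ^ kn) (b i (fromℕ p) - b i zero)
  b-closing-edge i kn≤ki =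
    subst (InIdeal m (a ^ kn)) (sym closing-difference) (power-in-ideal m a kn≤ki)
    where
    i<last : toℕ i ℕ.< toℕ (fromℕ p)
    i<last = subst (toℕ i ℕ.<_) (sym (Fin.toℕ-fromℕ p)) (Fin.toℕ<n i)

    closing-difference : b i (fromℕ p) - b i zero ≡ a ^ k i
    closing-difference =
      trans (cong₂ _-_ (b-above i (fromℕ p) i<last) (b-below i zero ℕ.z≤n)) (ℤ.+-identityʳ (a ^ k i))

  b-isSpline : ∀ i → kn ≤ k i → IsCycleSpline m p a k kn (b i)
  b-isSpline i kn≤ki = b-path-edge i , b-closing-edge i kn≤ki

  -- A spline f agrees modulo m with f(v₀)·1 + Σᵢ zᵢ·b⁽ⁱ⁾, where -zⱼ is the
  -- coefficient witnessing the spline condition on the edge ℓⱼ.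
  spline-inSpan : ∀ f → IsCycleSpline m p a k kn f → InSpan m p a k f
  spline-inSpan f (path-edges , _) = f zero , z , <-weakInduction Agrees start extend
    where
    z : Fin p → ℤ
    z j = - proj₁ (path-edges j)

    Agrees : Fin (suc p) → Set
    Agrees j = f j ≡ f zero * 1ℤ + combination z j [mod m ]

    start : Agrees zero
    start = ≡⇒≡[mod] (sym (begin
      f zero * 1ℤ + combination z zero ≡⟨ cong (λ s → f zero * 1ℤ + s) (combination-start z) ⟩
      f zero * 1ℤ + 0ℤ                 ≡⟨ ℤ.+-identityʳ (f zero * 1ℤ) ⟩
      f zero * 1ℤ                      ≡⟨ ℤ.*-identityʳ (f zero) ⟩
      f zero                           ∎))
      where open ≡-Reasoning

    extend : ∀ j → Agrees (inject₁ j) → Agrees (suc j)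
    extend j agrees = begin
      f (suc j)
        ≈⟨ mod-from-difference (f (inject₁ j)) (f (suc j)) (proj₁ (path-edges j)) (a ^ k j)
                               (proj₂ (path-edges j)) ⟩
      f (inject₁ j) + z j * a ^ k j
        ≈⟨ mod-+ʳ (f (inject₁ j)) _ (z j * a ^ k j) agrees ⟩
      (f zero * 1ℤ + combination z (inject₁ j)) + z j * a ^ k j
        ≡⟨ ℤ.+-assoc (f zero * 1ℤ) (combination z (inject₁ j)) (z j * a ^ k j) ⟩
      f zero * 1ℤ + (combination z (inject₁ j) + z j * a ^ k j)
        ≡⟨ cong (λ s → f zero * 1ℤ + s) (combination-step z j) ⟨
      f zero * 1ℤ + combination z (suc j)
        ∎
      where open import Relation.Binary.Reasoning.Setoid (modSetoid m)

-- Theorem 15.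
mainTheorem15 : (m : ℕ) → 2 ≤ m → (a : ℤ) → IsZeroDivisor m a →
    (p : ℕ) → 2 ≤ p → (k : Fin p → ℕ) → (kn : ℕ) → ((i : Fin p) → kn ≤ k i) →
    IsCycleSpline m p a k kn (one p)
    × ((i : Fin p) → IsCycleSpline m p a k kn (bvec p a k i))
    × ((f : Fin (suc p) → ℤ) → IsCycleSpline m p a k kn f → InSpan m p a k f)
mainTheorem15 m _ a _ p _ k kn kn-minimal =
  one-isSpline , (λ i → b-isSpline i (kn-minimal i)) , spline-inSpan
  where open CycleSplines m p a k kn
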